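{- Let $\mathbf A$ be an FL${}_{\mathrm e}$-algebra. (1) If $(\mathbf A,\Rightarrow_{\wedge})$ is proto-connexive, then $(\mathbf A,\Rightarrow_{\wedge})$ refutes (K1) or (K2) if and only if $\mathbf A$ satisfies $x\leq 0$ for all $x\in A$. (2) If $(\mathbf A,\Rightarrow_{\circ})$ is proto-connexive and refutes (K1) or (K2), then $1\leq 0$ in $\mathbf A$.
   Context: An FL${}_{\mathrm e}$-algebra is an algebra $\langle A,\wedge,\vee,\cdot,\to,0,1\rangle$ such that $\langle A,\wedge,\vee\rangle$ is a lattice (with order $\leq$), $\langle A,\cdot,1\rangle$ is a commutative monoid, $0$ is an arbitrary constant, and $x\cdot y\leq z\iff x\leq y\to z$. Write $\neg x:=x\to 0$, $x\Rightarrow_{\wedge} y:=(x\to y)\wedge(y\to\neg\neg x)$, $x\Rightarrow_{\circ} y:=(x\to y)\cdot(y\to\neg\neg x)$. $(\mathbf A,{\Rightarrow})$ is proto-connexive if for all $x,y$: $1\leq\neg(x{\Rightarrow}\neg x)$, $1\leq\neg(\neg x{\Rightarrow} x)$, $1\leq (x{\Rightarrow} y){\Rightarrow}\neg(x{\Rightarrow}\neg y)$, $1\leq (x{\Rightarrow}\neg y){\Rightarrow}\neg(x{\Rightarrow} y)$. $(\mathbf A,{\Rightarrow})$ refutes (K1) if there is $a\in A$ with $1\leq a{\Rightarrow}\neg a$ or $1\leq\neg a{\Rightarrow} a$; it refutes (K2) if there are $a,b\in A$ with $1\leq a{\Rightarrow} b$ and $1\leq a{\Rightarrow}\neg b$.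 -}

module Defs where

open import Level using (Level; suc; _⊔_)
open import Relation.Binary.PropositionalEquality using (_≡_)
open import Data.Product using (_×_; Σ-syntax; ∃-syntax)
open import Data.Sum using (_⊎_)
open import Function.Bundles using (_⇔_)

record FLe (a : Level) : Set (suc a) where
  infixr 6 _∨_
  infixr 7 _∧_
  infixl 8 _·_
  infixr 5 _⇒_
  infix 4 _≤_
  infix 9 ¬_
  field
    Carrier : Set a
    _∧_ _∨_ _·_ _⇒_ : Carrier → Carrier → Carrier
    𝟘 𝟙 : Carrier
    ∧-comm   : ∀ x y → x ∧ y ≡ y ∧ x
    ∨-comm   : ∀ x y → x ∨ y ≡ y ∨ x
    ∧-assoc  : ∀ x y z → (x ∧ y) ∧ z ≡ x ∧ (y ∧ z)
    ∨-assoc  : ∀ x y z → (x ∨ y) ∨ z ≡ x ∨ (y ∨ z)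
    ∧-absorbs-∨ : ∀ x y → x ∧ (x ∨ y) ≡ x
    ∨-absorbs-∧ : ∀ x y → x ∨ (x ∧ y) ≡ x
    ·-comm   : ∀ x y → x · y ≡ y · x
    ·-assoc  : ∀ x y z → (x · y) · z ≡ x · (y · z)
    ·-identityˡ : ∀ x → 𝟙 · x ≡ x

  _≤_ : Carrier → Carrier → Set a
  x ≤ y = x ∧ y ≡ x

  field
    residuation : ∀ x y z → (x · y ≤ z) ⇔ (x ≤ y ⇒ z)

  ¬_ : Carrier → Carrier
  ¬ x = x ⇒ 𝟘

  _⇒∧_ : Carrier → Carrier → Carrier
  x ⇒∧ y = (x ⇒ y) ∧ (y ⇒ ¬ ¬ x)

  _⇒∘_ : Carrier → Carrier → Carrier
  x ⇒∘ y = (x ⇒ y) · (y ⇒ ¬ ¬ x)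

  ProtoConnexive : (Carrier → Carrier → Carrier) → Set a
  ProtoConnexive I =
      (∀ x → 𝟙 ≤ ¬ (I x (¬ x)))
    × (∀ x → 𝟙 ≤ ¬ (I (¬ x) x))
    × (∀ x y → 𝟙 ≤ I (I x y) (¬ (I x (¬ y))))
    × (∀ x y → 𝟙 ≤ I (I x (¬ y)) (¬ (I x y)))

  RefutesK1 : (Carrier → Carrier → Carrier) → Set a
  RefutesK1 I = ∃[ a ] ((𝟙 ≤ I a (¬ a)) ⊎ (𝟙 ≤ I (¬ a) a))

  RefutesK2 : (Carrier → Carrier → Carrier) → Set a
  RefutesK2 I = ∃[ a ] ∃[ b ] ((𝟙 ≤ I a b) × (𝟙 ≤ I a (¬ b)))

{-# OPTIONS --safe #-}
module Submission where

open import Defs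
open import Level using (Level)
open import Data.Product using (_×_; _,_)
open import Data.Sum using (_⊎_; inj₁; inj₂; [_,_])
open import Function using (_∘_)
open import Function.Bundles using (_⇔_; mk⇔; Equivalence)
open import Relation.Binary.PropositionalEquality
  using (_≡_; sym; cong₂; subst; isEquivalence)
open import Relation.Binary.Bundles using (Poset)
import Relation.Binary.Lattice.Bundles as OrderLattice
open import Algebra.Bundles using (CommutativeSemigroup)
open import Algebra.Lattice.Bundles using (Lattice)
import Algebra.Lattice.Properties.Lattice as LatticeProperties
import Algebra.Properties.CommutativeSemigroup as CommutativeSemigroupProperties
import Relation.Binary.Reasoning.PartialOrder as PosetReasoning

-- A refutation of (K1) contradicts the first two axioms outright, giving 𝟙 ≤ 𝟘.  So does a
-- refutation 𝟙 ≤ a ⇒∧ b, 𝟙 ≤ a ⇒∧ ¬b of (K2), through the third axiom, because x ⇒∧ y ≤ x → y.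
-- For ⇒∘ such a refutation is turned into the (K1) refutation 𝟙 ≤ a ⇒∘ ¬a by multiplying the
-- two hypotheses: (x → y)·(x → ¬y) ≤ x → ¬x, applied to a, b and, after exchanging premises
-- in the converse factors, to ¬a, ¬b.  When 𝟙 ≤ 𝟘, enlarging x to w = x ∨ 𝟙 ≥ 𝟙
-- makes 𝟙 ⇒∧ w ≤ 𝟘, and the third axiom for ⇒∧ at 𝟙 gives x ≤ w ≤ ¬(𝟙 ⇒∧ ¬w) ≤ ¬¬(𝟙 ⇒∧ w) ≤ 𝟘.
-- Conversely, if everything is below 𝟘 then 𝟙 ≤ x → ¬y for all x, y, refuting (K1) at any a.

module FLeProperties {ℓ : Level} (A : FLe ℓ) where
  open FLe A

  lattice : Lattice ℓ ℓ
  lattice = record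
    { Carrier = Carrier ; _≈_ = _≡_ ; _∨_ = _∨_ ; _∧_ = _∧_
    ; isLattice = record
      { isEquivalence = isEquivalence
      ; ∨-comm = ∨-comm ; ∨-assoc = ∨-assoc ; ∨-cong = cong₂ _∨_
      ; ∧-comm = ∧-comm ; ∧-assoc = ∧-assoc ; ∧-cong = cong₂ _∧_
      ; absorptive = ∨-absorbs-∧ , ∧-absorbs-∨
      }
    }

  ·-commutativeSemigroup : CommutativeSemigroup ℓ ℓ
  ·-commutativeSemigroup = record
    { Carrier = Carrier ; _≈_ = _≡_ ; _∙_ = _·_
    ; isCommutativeSemigroup = record
      { isSemigroup = record
        { isMagma = record { isEquivalence = isEquivalence ; ∙-cong = cong₂ _·_ }
        ; assoc = ·-assoc
        }
      ; comm = ·-comm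
      }
    }

  open CommutativeSemigroupProperties ·-commutativeSemigroup using (interchange; xy∙z≈xz∙y)

  -- The library orders a lattice by x ≈ x ∧ y, the symmetric form of the order of FLe.
  private
    module Ordered = OrderLattice.Lattice (LatticeProperties.∨-∧-orderTheoreticLattice lattice)

  poset : Poset ℓ ℓ ℓ
  poset = record
    { _≤_ = _≤_
    ; isPartialOrder = record
      { isPreorder = record
        { isEquivalence = isEquivalence
        ; reflexive = sym ∘ Ordered.reflexive
        ; trans = λ p q → sym (Ordered.trans (sym p) (sym q))
        }
      ; antisym = λ p q → Ordered.antisym (sym p) (sym q)
      }
    }

  open Poset poset using () renaming (refl to ≤-refl; trans to ≤-trans)
  open PosetReasoning poset

  x∧y≤x : ∀ x y → x ∧ y ≤ x
  x∧y≤x x y = sym (Ordered.x∧y≤x x y)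

  x∧y≤y : ∀ x y → x ∧ y ≤ y
  x∧y≤y x y = sym (Ordered.x∧y≤y x y)

  ∧-greatest : ∀ {x y z} → x ≤ y → x ≤ z → x ≤ y ∧ z
  ∧-greatest p q = sym (Ordered.∧-greatest (sym p) (sym q))

  x≤x∨y : ∀ x y → x ≤ x ∨ y
  x≤x∨y x y = sym (Ordered.x≤x∨y x y)

  y≤x∨y : ∀ x y → y ≤ x ∨ y
  y≤x∨y x y = sym (Ordered.y≤x∨y x y)

  residual→ : ∀ {x y z} → x · y ≤ z → x ≤ y ⇒ z
  residual→ = Equivalence.to (residuation _ _ _)

  residual← : ∀ {x y z} → x ≤ y ⇒ z → x · y ≤ z
  residual← = Equivalence.from (residuation _ _ _)

  ·-identityʳ : ∀ x → x · 𝟙 ≡ x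
  ·-identityʳ x = subst (_≡ x) (·-comm 𝟙 x) (·-identityˡ x)

  modus-ponens : ∀ x y → (x ⇒ y) · x ≤ y
  modus-ponens x y = residual← ≤-refl

  ·-monoˡ-≤ : ∀ {x y} z → x ≤ y → x · z ≤ y · z
  ·-monoˡ-≤ z x≤y = residual← (≤-trans x≤y (residual→ ≤-refl))

  ·-monoʳ-≤ : ∀ z {x y} → x ≤ y → z · x ≤ z · y
  ·-monoʳ-≤ z {x} {y} x≤y = begin
    z · x  ≡⟨ ·-comm z x ⟩
    x · z  ≤⟨ ·-monoˡ-≤ z x≤y ⟩
    y · z  ≡⟨ ·-comm y z ⟩
    z · y  ∎

  ·-mono-≤ : ∀ {x y u v} → x ≤ y → u ≤ v → x · u ≤ y · v
  ·-mono-≤ {y = y} {u} x≤y u≤v = ≤-trans (·-monoˡ-≤ u x≤y) (·-monoʳ-≤ y u≤v)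

  ·-inflationary : ∀ x {y} → 𝟙 ≤ y → x ≤ x · y
  ·-inflationary x 𝟙≤y = begin
    x      ≡⟨ ·-identityʳ x ⟨
    x · 𝟙  ≤⟨ ·-monoʳ-≤ x 𝟙≤y ⟩
    x · _  ∎

  𝟙≤⇒⇒≤ : ∀ {x y} → 𝟙 ≤ x ⇒ y → x ≤ y
  𝟙≤⇒⇒≤ {x} 𝟙≤x⇒y = subst (_≤ _) (·-identityˡ x) (residual← 𝟙≤x⇒y)

  ≤⇒𝟙≤⇒ : ∀ {x y} → x ≤ y → 𝟙 ≤ x ⇒ y
  ≤⇒𝟙≤⇒ {x} x≤y = residual→ (subst (_≤ _) (sym (·-identityˡ x)) x≤y)

  𝟙⇒x≤x : ∀ x → 𝟙 ⇒ x ≤ x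
  𝟙⇒x≤x x = subst (_≤ x) (·-identityʳ (𝟙 ⇒ x)) (modus-ponens 𝟙 x)

  ≤⇒-swap : ∀ {x y z} → x ≤ y ⇒ z → y ≤ x ⇒ z
  ≤⇒-swap {x} {y} x≤y⇒z = residual→ (subst (_≤ _) (·-comm x y) (residual← x≤y⇒z))

  ⇒-exchange : ∀ x y z → x ⇒ (y ⇒ z) ≤ y ⇒ (x ⇒ z)
  ⇒-exchange x y z =
    residual→ (residual→ (subst (_≤ z) (xy∙z≈xz∙y (x ⇒ (y ⇒ z)) x y) (residual← (residual← ≤-refl))))

  ≤𝟘⇒¬¬≤𝟘 : ∀ {x} → x ≤ 𝟘 → ¬ ¬ x ≤ 𝟘
  ≤𝟘⇒¬¬≤𝟘 {x} x≤𝟘 = begin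
    ¬ ¬ x        ≤⟨ ·-inflationary (¬ ¬ x) (≤⇒𝟙≤⇒ x≤𝟘) ⟩
    ¬ ¬ x · ¬ x  ≤⟨ modus-ponens (¬ x) 𝟘 ⟩
    𝟘            ∎

  ⇒-clash : ∀ x y → (x ⇒ y) · (x ⇒ ¬ y) ≤ x ⇒ ¬ x
  ⇒-clash x y = residual→ (residual→ (begin
    (x ⇒ y) · (x ⇒ ¬ y) · x · x      ≡⟨ ·-assoc ((x ⇒ y) · (x ⇒ ¬ y)) x x ⟩
    (x ⇒ y) · (x ⇒ ¬ y) · (x · x)    ≡⟨ interchange (x ⇒ y) (x ⇒ ¬ y) x x ⟩
    (x ⇒ y) · x · ((x ⇒ ¬ y) · x)    ≤⟨ ·-mono-≤ (modus-ponens x y) (modus-ponens x (¬ y)) ⟩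
    y · ¬ y                          ≡⟨ ·-comm y (¬ y) ⟩
    ¬ y · y                          ≤⟨ modus-ponens y 𝟘 ⟩
    𝟘                                ∎))

  𝟙≤x⇒𝟙≤¬x⇒𝟙≤𝟘 : ∀ {x} → 𝟙 ≤ x → 𝟙 ≤ ¬ x → 𝟙 ≤ 𝟘
  𝟙≤x⇒𝟙≤¬x⇒𝟙≤𝟘 𝟙≤x 𝟙≤¬x = ≤-trans 𝟙≤x (𝟙≤⇒⇒≤ 𝟙≤¬x)

  refutesK1⇒𝟙≤𝟘 : ∀ I → ProtoConnexive I → RefutesK1 I → 𝟙 ≤ 𝟘
  refutesK1⇒𝟙≤𝟘 _ (ax₁ , _ , _ , _) (a , inj₁ 𝟙≤Ia¬a) = 𝟙≤x⇒𝟙≤¬x⇒𝟙≤𝟘 𝟙≤Ia¬a (ax₁ a)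
  refutesK1⇒𝟙≤𝟘 _ (_ , ax₂ , _ , _) (a , inj₂ 𝟙≤I¬aa) = 𝟙≤x⇒𝟙≤¬x⇒𝟙≤𝟘 𝟙≤I¬aa (ax₂ a)

  refutesK2⇒𝟙≤𝟘 : ∀ I → (∀ x y → I x y ≤ x ⇒ y) →
                  ProtoConnexive I → RefutesK2 I → 𝟙 ≤ 𝟘
  refutesK2⇒𝟙≤𝟘 _ I≤⇒ (_ , _ , ax₃ , _) (a , b , 𝟙≤Iab , 𝟙≤Ia¬b) =
    𝟙≤x⇒𝟙≤¬x⇒𝟙≤𝟘 𝟙≤Ia¬b (≤-trans 𝟙≤Iab (𝟙≤⇒⇒≤ (≤-trans (ax₃ a b) (I≤⇒ _ _))))

  ⇒∧-≤-⇒ : ∀ x y → x ⇒∧ y ≤ x ⇒ y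
  ⇒∧-≤-⇒ x y = x∧y≤x (x ⇒ y) (y ⇒ ¬ ¬ x)

  ¬[⇒∧¬]≤¬¬[⇒∧] : ProtoConnexive _⇒∧_ → ∀ x y → ¬ (x ⇒∧ (¬ y)) ≤ ¬ ¬ (x ⇒∧ y)
  ¬[⇒∧¬]≤¬¬[⇒∧] (_ , _ , ax₃ , _) x y = 𝟙≤⇒⇒≤ (≤-trans (ax₃ x y) (x∧y≤y _ _))

  x≤¬[𝟙⇒∧¬x] : ∀ x → x ≤ ¬ (𝟙 ⇒∧ (¬ x))
  x≤¬[𝟙⇒∧¬x] x = ≤⇒-swap (≤-trans (⇒∧-≤-⇒ 𝟙 (¬ x)) (𝟙⇒x≤x (¬ x)))

  𝟙⇒∧x≤𝟘 : 𝟙 ≤ 𝟘 → ∀ {x} → 𝟙 ≤ x → 𝟙 ⇒∧ x ≤ 𝟘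
  𝟙⇒∧x≤𝟘 𝟙≤𝟘 {x} 𝟙≤x = begin
    𝟙 ⇒∧ x            ≤⟨ ·-inflationary (𝟙 ⇒∧ x) 𝟙≤x ⟩
    𝟙 ⇒∧ x · x        ≤⟨ ·-inflationary (𝟙 ⇒∧ x · x) (≤⇒𝟙≤⇒ 𝟙≤𝟘) ⟩
    𝟙 ⇒∧ x · x · ¬ 𝟙  ≤⟨ residual← (residual← (x∧y≤y (𝟙 ⇒ x) (x ⇒ ¬ ¬ 𝟙))) ⟩
    𝟘                 ∎

  𝟙≤𝟘⇒≤𝟘 : ProtoConnexive _⇒∧_ → 𝟙 ≤ 𝟘 → ∀ x → x ≤ 𝟘
  𝟙≤𝟘⇒≤𝟘 pc 𝟙≤𝟘 x = begin
    x               ≤⟨ x≤x∨y x 𝟙 ⟩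
    w               ≤⟨ x≤¬[𝟙⇒∧¬x] w ⟩
    ¬ (𝟙 ⇒∧ (¬ w))  ≤⟨ ¬[⇒∧¬]≤¬¬[⇒∧] pc 𝟙 w ⟩
    ¬ ¬ (𝟙 ⇒∧ w)    ≤⟨ ≤𝟘⇒¬¬≤𝟘 (𝟙⇒∧x≤𝟘 𝟙≤𝟘 (y≤x∨y x 𝟙)) ⟩
    𝟘               ∎
    where w = x ∨ 𝟙

  ≤𝟘⇒refutesK1 : (∀ x → x ≤ 𝟘) → RefutesK1 _⇒∧_
  ≤𝟘⇒refutesK1 ≤𝟘 = 𝟙 , inj₁ (∧-greatest (𝟙≤⇒¬ 𝟙 𝟙) (𝟙≤⇒¬ (¬ 𝟙) (¬ 𝟙)))
    where
    𝟙≤⇒¬ : ∀ x y → 𝟙 ≤ x ⇒ ¬ y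
    𝟙≤⇒¬ x y = residual→ (residual→ (≤𝟘 (𝟙 · x · y)))

  ⇒∘-clash : ∀ x y → (x ⇒∘ y) · (x ⇒∘ (¬ y)) ≤ x ⇒∘ (¬ x)
  ⇒∘-clash x y = begin
    (x ⇒∘ y) · (x ⇒∘ (¬ y))
      ≡⟨ interchange (x ⇒ y) (y ⇒ ¬ ¬ x) (x ⇒ ¬ y) (¬ y ⇒ ¬ ¬ x) ⟩
    (x ⇒ y) · (x ⇒ ¬ y) · ((y ⇒ ¬ ¬ x) · (¬ y ⇒ ¬ ¬ x))
      ≤⟨ ·-monoʳ-≤ _ (·-mono-≤ (⇒-exchange y (¬ x) 𝟘) (⇒-exchange (¬ y) (¬ x) 𝟘)) ⟩
    (x ⇒ y) · (x ⇒ ¬ y) · ((¬ x ⇒ ¬ y) · (¬ x ⇒ ¬ ¬ y))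
      ≤⟨ ·-mono-≤ (⇒-clash x y) (⇒-clash (¬ x) (¬ y)) ⟩
    x ⇒∘ (¬ x)
      ∎

  refutesK2⇒refutesK1-⇒∘ : RefutesK2 _⇒∘_ → RefutesK1 _⇒∘_
  refutesK2⇒refutesK1-⇒∘ (a , b , 𝟙≤a⇒∘b , 𝟙≤a⇒∘¬b) = a , inj₁ (begin
    𝟙                        ≡⟨ ·-identityˡ 𝟙 ⟨
    𝟙 · 𝟙                    ≤⟨ ·-mono-≤ 𝟙≤a⇒∘b 𝟙≤a⇒∘¬b ⟩
    (a ⇒∘ b) · (a ⇒∘ (¬ b))  ≤⟨ ⇒∘-clash a b ⟩
    a ⇒∘ (¬ a)               ∎)

proposition4p12 : ∀ {ℓ : Level} (A : FLe ℓ) → let open FLe A in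
    (ProtoConnexive _⇒∧_ → ((RefutesK1 _⇒∧_ ⊎ RefutesK2 _⇒∧_) ⇔ (∀ x → x ≤ 𝟘)))
    × (ProtoConnexive _⇒∘_ → RefutesK1 _⇒∘_ ⊎ RefutesK2 _⇒∘_ → 𝟙 ≤ 𝟘)
proposition4p12 A =
    (λ pc → mk⇔ (𝟙≤𝟘⇒≤𝟘 pc ∘ [ refutesK1⇒𝟙≤𝟘 _⇒∧_ pc , refutesK2⇒𝟙≤𝟘 _⇒∧_ ⇒∧-≤-⇒ pc ])
                (inj₁ ∘ ≤𝟘⇒refutesK1))
  , λ pc → [ refutesK1⇒𝟙≤𝟘 _⇒∘_ pc , refutesK1⇒𝟙≤𝟘 _⇒∘_ pc ∘ refutesK2⇒refutesK1-⇒∘ ]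
  where open FLe A; open FLeProperties A
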